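{- (i) Let $S,N$ be integers with $S>1$ and $N>2$. There exists a non-disjoint $(S^N,N,S^{N-1},S^{N-2})$-PSEDF in $\mathbb{Z}_{S^N}$, and hence a non-disjoint $(S^N,N,S^{N-1},(N-1)S^{N-2})$-SEDF in $\mathbb{Z}_{S^N}$. (ii) Let $x,y\in\mathbb{N}$ with $x<y$. There exists a non-disjoint $(y^2,2,xy,x^2)$-PSEDF in $\mathbb{Z}_{y^2}$, and hence a non-disjoint $(y^2,2,xy,x^2)$-SEDF in $\mathbb{Z}_{y^2}$.
   Context: For subsets $A,B$ of an additively written group $G$, $\Delta(A,B)$ denotes the multiset $\{a-b:a\in A,b\in B\}$ (one entry per pair); multiset unions are taken with multiplicity. For $\lambda\in\mathbb{N}$, $\lambda G$ is the multiset containing every element of $G$ exactly $\lambda$ times. Let $G$ be a group of order $v$ and $m>1$. A family of $k$-subsets $\{A_1,\dots,A_m\}$ of $G$ is a non-disjoint $(v,m,k,\lambda)$-PSEDF if $\Delta(A_i,A_j)=\lambda G$ for all $1\le i\ne j\le m$; it is a non-disjoint $(v,m,k,\lambda)$-SEDF if for each $1\le i\le m$, the multiset union $\bigcup_{j\ne i}\Delta(A_i,A_j)$ equals $\lambda G$. -}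

module Defs where

open import Data.Nat using (ℕ; zero; suc; _+_; _*_; _∸_; _^_; _<_)
open import Data.Nat.Properties using (_≟_)
open import Data.Fin using (Fin; toℕ)
import Data.Fin as F
open import Data.Fin.Subset using (Subset; ∣_∣; inside)
open import Data.Vec using (lookup)
open import Data.List using (List; map; allFin)
open import Data.Nat.ListAction using (sum)
open import Data.Bool using (Bool; true; false; _∧_; _∨_; if_then_else_)
open import Data.Product using (_×_)
open import Relation.Nullary using (does; ¬_)
open import Relation.Binary.PropositionalEquality using (_≡_)

Σfin : (n : ℕ) → (Fin n → ℕ) → ℕ
Σfin n f = sum (map f (allFin n))

-- Subtraction in the cyclic group ℤ_n (elements represented by Fin n):
-- a - b ≡ g in ℤ_n  iff  b + g ≡ a (mod n); since a, b, g < n this means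
-- b + g = a  or  b + g = a + n.
diffIs : {n : ℕ} → Fin n → Fin n → Fin n → Bool
diffIs {n} a b g =
  does (toℕ b + toℕ g ≟ toℕ a) ∨ does (toℕ b + toℕ g ≟ toℕ a + n)

mem : {n : ℕ} → Subset n → Fin n → Bool
mem A a = lookup A a

-- Multiplicity of g in the multiset Δ(A,B) = {a - b : a ∈ A, b ∈ B}.
Δmult : {n : ℕ} → Subset n → Subset n → Fin n → ℕ
Δmult {n} A B g =
  Σfin n λ a → Σfin n λ b →
    if mem A a ∧ mem B b ∧ diffIs a b g then 1 else 0

ΔIsλG : {n : ℕ} → Subset n → Subset n → ℕ → Set
ΔIsλG {n} A B λ' = (g : Fin n) → Δmult A B g ≡ λ'

AllKSubsets : (v m k : ℕ) → (Fin m → Subset v) → Set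
AllKSubsets v m k A = (i : Fin m) → ∣ A i ∣ ≡ k

IsPSEDF : (v m k λ' : ℕ) → (Fin m → Subset v) → Set
IsPSEDF v m k λ' A =
  1 < m × AllKSubsets v m k A ×
  ((i j : Fin m) → ¬ (i ≡ j) → ΔIsλG (A i) (A j) λ')

-- Non-disjoint (v,m,k,λ)-SEDF in ℤ_v: for each i, the multiset union
-- over j ≠ i of Δ(A_i,A_j) equals λ ℤ_v (multiplicities add up).
IsSEDF : (v m k λ' : ℕ) → (Fin m → Subset v) → Set
IsSEDF v m k λ' A =
  1 < m × AllKSubsets v m k A ×
  ((i : Fin m) (g : Fin v) →
    Σfin m (λ j → if does (i F.≟ j) then 0 else Δmult (A i) (A j) g) ≡ λ')

module Submission where

-- Write n ∈ ℤ_{QP} as n = qP + r with r < P. If α depends only on r, and β = {n : ⌊n/P⌋ ∈ w}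
-- depends only on q, then for every shift h the number of b ∈ β with b + h ∈ α is
-- |α ∩ [0,P)| · |w|, because for fixed q the residues (r + h) mod P run over a rotation of [0,P).
-- So Δ(α,β) is constant, and so is Δ(β,α) since Δ(β,α)(g) = Δ(α,β)(-g). For (i) take, in base S,
-- α = {n : digit a of n is 0} and β = {n : digit b of n is 0} with a < b and P = S^(a+1); for (ii)
-- take α = {n : n mod y < x} and β = {n : ⌊n/y⌋ < x} with P = Q = y. Summing a PSEDF over the
-- m - 1 partners of each set gives the SEDF.

open import Defs
open import Data.Nat using (ℕ; zero; suc; _+_; _*_; _∸_; _^_; _<_; _≤_; z≤n; s≤s; z<s; s<s; NonZero; _<ᵇ_; _≡ᵇ_; _%_; _/_)
open import Data.Nat.Properties
open import Data.Nat.DivMod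
open import Algebra.Properties.CommutativeSemigroup +-commutativeSemigroup using (interchange)
open import Data.Nat.Divisibility using (_∣_; divides; n∣m*n)
open import Data.Fin using (Fin; toℕ)
import Data.Fin as F
open import Data.Fin.Properties using (toℕ<n; toℕ-injective)
open import Data.Fin.Subset using (Subset; ∣_∣)
import Data.Vec as V
open import Data.Vec.Properties using (lookup∘tabulate)
import Data.List as L
open import Data.List.Properties using (map-tabulate)
open import Data.Nat.ListAction using (sum)
open import Data.Bool using (Bool; true; false; _∧_; if_then_else_)
open import Data.Product using (_×_; Σ; _,_)
open import Data.Sum using (_⊎_; inj₁; inj₂)
open import Function using (_∘_; _⇔_; mk⇔)
open import Relation.Nullary using (does; ¬_; yes; no; contradiction)
open import Relation.Nullary.Decidable using (does-⇔; dec-true; dec-false; _⊎-dec_)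
open import Relation.Binary using (tri<; tri≈; tri>)
open import Relation.Binary.PropositionalEquality
open ≡-Reasoning

𝟙 : Bool → ℕ
𝟙 b = if b then 1 else 0

∑ : ℕ → (ℕ → ℕ) → ℕ
∑ zero    f = 0
∑ (suc n) f = f 0 + ∑ n (f ∘ suc)

count : ℕ → (ℕ → Bool) → ℕ
count n p = ∑ n (𝟙 ∘ p)

∑-cong : ∀ n {f g : ℕ → ℕ} → (∀ k → k < n → f k ≡ g k) → ∑ n f ≡ ∑ n g
∑-cong zero    f≡g = refl
∑-cong (suc n) f≡g = cong₂ _+_ (f≡g 0 z<s) (∑-cong n (λ k k<n → f≡g (suc k) (s<s k<n)))

∑-const : ∀ n c → ∑ n (λ _ → c) ≡ n * c
∑-const zero    c = refl
∑-const (suc n) c = cong (c +_) (∑-const n c)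

∑-zero : ∀ n → ∑ n (λ _ → 0) ≡ 0
∑-zero n = trans (∑-const n 0) (*-zeroʳ n)

∑-distrib-+ : ∀ n (f g : ℕ → ℕ) → ∑ n (λ k → f k + g k) ≡ ∑ n f + ∑ n g
∑-distrib-+ zero    f g = refl
∑-distrib-+ (suc n) f g = begin
  (f 0 + g 0) + ∑ n (λ k → f (suc k) + g (suc k))
    ≡⟨ cong ((f 0 + g 0) +_) (∑-distrib-+ n (f ∘ suc) (g ∘ suc)) ⟩
  (f 0 + g 0) + (∑ n (f ∘ suc) + ∑ n (g ∘ suc))
    ≡⟨ interchange (f 0) (g 0) _ _ ⟩
  (f 0 + ∑ n (f ∘ suc)) + (g 0 + ∑ n (g ∘ suc)) ∎

∑-distribˡ-* : ∀ n c (f : ℕ → ℕ) → ∑ n (λ k → c * f k) ≡ c * ∑ n f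
∑-distribˡ-* zero    c f = sym (*-zeroʳ c)
∑-distribˡ-* (suc n) c f =
  trans (cong (c * f 0 +_) (∑-distribˡ-* n c (f ∘ suc))) (sym (*-distribˡ-+ c (f 0) _))

∑-distribʳ-* : ∀ n c (f : ℕ → ℕ) → ∑ n (λ k → f k * c) ≡ ∑ n f * c
∑-distribʳ-* n c f = begin
  ∑ n (λ k → f k * c) ≡⟨ ∑-cong n (λ k _ → *-comm (f k) c) ⟩
  ∑ n (λ k → c * f k) ≡⟨ ∑-distribˡ-* n c f ⟩
  c * ∑ n f           ≡⟨ *-comm c _ ⟩
  ∑ n f * c           ∎

∑-+ : ∀ m n (f : ℕ → ℕ) → ∑ (m + n) f ≡ ∑ m f + ∑ n (λ k → f (m + k))
∑-+ zero    n f = refl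
∑-+ (suc m) n f = trans (cong (f 0 +_) (∑-+ m n (f ∘ suc))) (sym (+-assoc (f 0) _ _))

∑-* : ∀ Q P (f : ℕ → ℕ) → ∑ (Q * P) f ≡ ∑ Q (λ q → ∑ P (λ r → f (q * P + r)))
∑-* zero    P f = refl
∑-* (suc Q) P f = begin
  ∑ (P + Q * P) f
    ≡⟨ ∑-+ P (Q * P) f ⟩
  ∑ P f + ∑ (Q * P) (λ k → f (P + k))
    ≡⟨ cong (∑ P f +_) (∑-* Q P (λ k → f (P + k))) ⟩
  ∑ P f + ∑ Q (λ q → ∑ P (λ r → f (P + (q * P + r))))
    ≡⟨ cong (∑ P f +_) (∑-cong Q (λ q _ → ∑-cong P (λ r _ → cong f (sym (+-assoc P (q * P) r))))) ⟩
  ∑ P f + ∑ Q (λ q → ∑ P (λ r → f (suc q * P + r))) ∎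

∑-comm : ∀ m n (f : ℕ → ℕ → ℕ) → ∑ m (λ a → ∑ n (f a)) ≡ ∑ n (λ b → ∑ m (λ a → f a b))
∑-comm zero    n f = sym (∑-zero n)
∑-comm (suc m) n f = begin
  ∑ n (f 0) + ∑ m (λ a → ∑ n (f (suc a)))
    ≡⟨ cong (∑ n (f 0) +_) (∑-comm m n (f ∘ suc)) ⟩
  ∑ n (f 0) + ∑ n (λ b → ∑ m (λ a → f (suc a) b))
    ≡⟨ sym (∑-distrib-+ n (f 0) _) ⟩
  ∑ n (λ b → f 0 b + ∑ m (λ a → f (suc a) b)) ∎

∑-select : ∀ {n c} (f : ℕ → ℕ) → c < n → ∑ n (λ k → if does (k ≟ c) then f k else 0) ≡ f c
∑-select {suc n} {zero}  f _         = trans (cong (f 0 +_) (∑-zero n)) (+-identityʳ (f 0))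
∑-select {suc n} {suc c} f (s≤s c<n) = ∑-select (f ∘ suc) c<n

∑-all-but-one : ∀ {m c} K → c < m → ∑ m (λ k → if does (k ≟ c) then 0 else K) ≡ (m ∸ 1) * K
∑-all-but-one {suc m}       {zero}  K _         = ∑-const m K
∑-all-but-one {suc (suc m)} {suc c} K (s≤s c<m) = cong (K +_) (∑-all-but-one K c<m)

∑-suc-last : ∀ n (f : ℕ → ℕ) → ∑ (suc n) f ≡ ∑ n f + f n
∑-suc-last zero    f = +-comm (f 0) 0
∑-suc-last (suc n) f = trans (cong (f 0 +_) (∑-suc-last n (f ∘ suc))) (sym (+-assoc (f 0) _ _))

[m%n+o]%n≡[m+o]%n : ∀ m o n .{{_ : NonZero n}} → (m % n + o) % n ≡ (m + o) % n
[m%n+o]%n≡[m+o]%n m o n = begin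
  (m % n + o) % n         ≡⟨ %-distribˡ-+ (m % n) o n ⟩
  (m % n % n + o % n) % n ≡⟨ cong (λ x → (x + o % n) % n) (m%n%n≡m%n m n) ⟩
  (m % n + o % n) % n     ≡⟨ sym (%-distribˡ-+ m o n) ⟩
  (m + o) % n             ∎

∑-rotate-1 : ∀ n (f : ℕ → ℕ) → ∑ (suc n) (λ r → f ((r + 1) % suc n)) ≡ ∑ (suc n) f
∑-rotate-1 n f = begin
  ∑ (suc n) (λ r → f ((r + 1) % suc n))
    ≡⟨ ∑-suc-last n _ ⟩
  ∑ n (λ r → f ((r + 1) % suc n)) + f ((n + 1) % suc n)
    ≡⟨ cong₂ _+_ (∑-cong n (λ r r<n → cong f (r+1%n≡1+r r<n))) (cong f n+1%n≡0) ⟩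
  ∑ n (f ∘ suc) + f 0
    ≡⟨ +-comm _ (f 0) ⟩
  ∑ (suc n) f ∎
  where
  r+1%n≡1+r : ∀ {r} → r < n → (r + 1) % suc n ≡ suc r
  r+1%n≡1+r {r} r<n = trans (cong (_% suc n) (+-comm r 1)) (m<n⇒m%n≡m (s<s r<n))
  n+1%n≡0 : (n + 1) % suc n ≡ 0
  n+1%n≡0 = trans (cong (_% suc n) (+-comm n 1)) (n%n≡0 (suc n))

∑-rotate : ∀ n .{{_ : NonZero n}} g (f : ℕ → ℕ) → ∑ n (λ r → f ((r + g) % n)) ≡ ∑ n f
∑-rotate n zero f = ∑-cong n (λ r r<n → cong f (trans (cong (_% n) (+-identityʳ r)) (m<n⇒m%n≡m r<n)))
∑-rotate n@(suc n-1) (suc g) f = begin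
  ∑ n (λ r → f ((r + suc g) % n))
    ≡⟨ ∑-cong n (λ r _ → cong f (shift r)) ⟩
  ∑ n (λ r → f (((r + 1) % n + g) % n))
    ≡⟨ ∑-rotate-1 n-1 (λ x → f ((x + g) % n)) ⟩
  ∑ n (λ r → f ((r + g) % n))
    ≡⟨ ∑-rotate n g f ⟩
  ∑ n f ∎
  where
  shift : ∀ r → (r + suc g) % n ≡ ((r + 1) % n + g) % n
  shift r = trans (cong (_% n) (sym (+-assoc r 1 g))) (sym ([m%n+o]%n≡[m+o]%n (r + 1) g n))

∑-divMod : ∀ Q P .{{_ : NonZero P}} (f g : ℕ → ℕ) →
           ∑ (Q * P) (λ n → f (n % P) * g (n / P)) ≡ ∑ P f * ∑ Q g
∑-divMod Q P f g = begin
  ∑ (Q * P) (λ n → f (n % P) * g (n / P))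
    ≡⟨ ∑-* Q P _ ⟩
  ∑ Q (λ q → ∑ P (λ r → f ((q * P + r) % P) * g ((q * P + r) / P)))
    ≡⟨ ∑-cong Q (λ q _ → ∑-cong P (λ r r<P → cong₂ (λ x y → f x * g y) (mod q r<P) (div q r<P))) ⟩
  ∑ Q (λ q → ∑ P (λ r → f r * g q))
    ≡⟨ ∑-cong Q (λ q _ → ∑-distribʳ-* P (g q) f) ⟩
  ∑ Q (λ q → ∑ P f * g q)
    ≡⟨ ∑-distribˡ-* Q (∑ P f) g ⟩
  ∑ P f * ∑ Q g ∎
  where
  mod : ∀ q {r} → r < P → (q * P + r) % P ≡ r
  mod q {r} r<P = trans (%-remove-+ˡ r (n∣m*n q)) (m<n⇒m%n≡m r<P)
  div : ∀ q {r} → r < P → (q * P + r) / P ≡ q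
  div q {r} r<P = begin
    (q * P + r) / P     ≡⟨ +-distrib-/-∣ˡ r (n∣m*n q) ⟩
    q * P / P + r / P   ≡⟨ cong₂ _+_ (m*n/n≡m q P) (m<n⇒m/n≡0 r<P) ⟩
    q + 0               ≡⟨ +-identityʳ q ⟩
    q                   ∎

Σfin≡∑ : ∀ n {f : Fin n → ℕ} {h : ℕ → ℕ} → (∀ i → f i ≡ h (toℕ i)) → Σfin n f ≡ ∑ n h
Σfin≡∑ n {f} f≡h = trans (cong sum (map-tabulate (λ i → i) f)) (sum-tabulate n f≡h)
  where
  sum-tabulate : ∀ n {f : Fin n → ℕ} {h : ℕ → ℕ} → (∀ i → f i ≡ h (toℕ i)) → sum (L.tabulate f) ≡ ∑ n h
  sum-tabulate zero    f≡h = refl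
  sum-tabulate (suc n) f≡h = cong₂ _+_ (f≡h F.zero) (sum-tabulate n (f≡h ∘ F.suc))

subset : (v : ℕ) → (ℕ → Bool) → Subset v
subset v p = V.tabulate (p ∘ toℕ)

∣subset∣ : ∀ v (p : ℕ → Bool) → ∣ subset v p ∣ ≡ count v p
∣subset∣ zero    p = refl
∣subset∣ (suc v) p with p 0
... | true  = cong suc (∣subset∣ v (p ∘ suc))
... | false = ∣subset∣ v (p ∘ suc)

overlapAt : (v : ℕ) .{{_ : NonZero v}} → (ℕ → Bool) → (ℕ → Bool) → ℕ → ℕ
overlapAt v α β h = ∑ v (λ b → 𝟙 (α ((b + h) % v)) * 𝟙 (β b))

b+g≡a⊎b+g≡a+v⇔a≡[b+g]%v : ∀ {v} .{{_ : NonZero v}} {a b g} → a < v → b < v → g ≤ v →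
              (b + g ≡ a ⊎ b + g ≡ a + v) ⇔ a ≡ (b + g) % v
b+g≡a⊎b+g≡a+v⇔a≡[b+g]%v {v} {a} {b} {g} a<v b<v g≤v = mk⇔ to from
  where
  to : b + g ≡ a ⊎ b + g ≡ a + v → a ≡ (b + g) % v
  to (inj₁ b+g≡a)   = sym (trans (cong (_% v) b+g≡a) (m<n⇒m%n≡m a<v))
  to (inj₂ b+g≡a+v) = sym (trans (cong (_% v) b+g≡a+v) (trans ([m+n]%n≡m%n a v) (m<n⇒m%n≡m a<v)))
  from : a ≡ (b + g) % v → b + g ≡ a ⊎ b + g ≡ a + v
  from a≡ with b + g <? v
  ... | yes b+g<v = inj₁ (sym (trans a≡ (m<n⇒m%n≡m b+g<v)))
  ... | no  b+g≮v = inj₂ (begin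
    b + g               ≡⟨ sym (m∸n+n≡m v≤b+g) ⟩
    b + g ∸ v + v       ≡⟨ cong (_+ v) (sym (m<n⇒m%n≡m b+g∸v<v)) ⟩
    (b + g ∸ v) % v + v ≡⟨ cong (_+ v) (m≤n⇒[n∸m]%m≡n%m v≤b+g) ⟩
    (b + g) % v + v     ≡⟨ cong (_+ v) (sym a≡) ⟩
    a + v               ∎)
    where
    v≤b+g : v ≤ b + g
    v≤b+g = ≮⇒≥ b+g≮v
    b+g∸v<v : b + g ∸ v < v
    b+g∸v<v = +-cancelʳ-< v _ v (subst (_< v + v) (sym (m∸n+n≡m v≤b+g)) (+-mono-<-≤ b<v g≤v))

diffIs≡ : ∀ {v} .{{_ : NonZero v}} (a b g : Fin v) → diffIs a b g ≡ does (toℕ a ≟ (toℕ b + toℕ g) % v)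
diffIs≡ a b g = does-⇔ (b+g≡a⊎b+g≡a+v⇔a≡[b+g]%v (toℕ<n a) (toℕ<n b) (<⇒≤ (toℕ<n g)))
                       ((_ ≟ _) ⊎-dec (_ ≟ _)) (_ ≟ _)

𝟙-∧-∧ : ∀ x y z → 𝟙 (x ∧ y ∧ z) ≡ (if z then 𝟙 x * 𝟙 y else 0)
𝟙-∧-∧ true  true  true  = refl
𝟙-∧-∧ true  true  false = refl
𝟙-∧-∧ true  false true  = refl
𝟙-∧-∧ true  false false = refl
𝟙-∧-∧ false _     true  = refl
𝟙-∧-∧ false _     false = refl

Δmult-subset : ∀ {v} .{{_ : NonZero v}} (α β : ℕ → Bool) (g : Fin v) →
               Δmult (subset v α) (subset v β) g ≡ overlapAt v α β (toℕ g)
Δmult-subset {v} α β g = begin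
  Δmult (subset v α) (subset v β) g
    ≡⟨ Σfin≡∑ v (λ a → Σfin≡∑ v (λ b → pointwise a b)) ⟩
  ∑ v (λ a → ∑ v (λ b → if does (a ≟ (b + h) % v) then 𝟙 (α a) * 𝟙 (β b) else 0))
    ≡⟨ ∑-comm v v _ ⟩
  ∑ v (λ b → ∑ v (λ a → if does (a ≟ (b + h) % v) then 𝟙 (α a) * 𝟙 (β b) else 0))
    ≡⟨ ∑-cong v (λ b _ → ∑-select (λ a → 𝟙 (α a) * 𝟙 (β b)) (m%n<n (b + h) v)) ⟩
  overlapAt v α β h ∎
  where
  h = toℕ g
  pointwise : ∀ a b → 𝟙 (mem (subset v α) a ∧ mem (subset v β) b ∧ diffIs a b g)
                    ≡ (if does (toℕ a ≟ (toℕ b + h) % v) then 𝟙 (α (toℕ a)) * 𝟙 (β (toℕ b)) else 0)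
  pointwise a b = begin
    𝟙 (mem (subset v α) a ∧ mem (subset v β) b ∧ diffIs a b g)
      ≡⟨ cong₂ (λ x y → 𝟙 (x ∧ y ∧ diffIs a b g)) (lookup∘tabulate _ a) (lookup∘tabulate _ b) ⟩
    𝟙 (α (toℕ a) ∧ β (toℕ b) ∧ diffIs a b g)
      ≡⟨ 𝟙-∧-∧ (α (toℕ a)) (β (toℕ b)) _ ⟩
    (if diffIs a b g then 𝟙 (α (toℕ a)) * 𝟙 (β (toℕ b)) else 0)
      ≡⟨ cong (λ z → if z then 𝟙 (α (toℕ a)) * 𝟙 (β (toℕ b)) else 0) (diffIs≡ a b g) ⟩
    _ ∎

overlapAt-flip : ∀ {v} .{{_ : NonZero v}} (α β : ℕ → Bool) {h} → h ≤ v →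
                 overlapAt v α β h ≡ overlapAt v β α (v ∸ h)
overlapAt-flip {v} α β {h} h≤v = begin
  ∑ v F
    ≡⟨ sym (∑-rotate v (v ∸ h) F) ⟩
  ∑ v (F ∘ a-h)
    ≡⟨ ∑-cong v (λ a a<v → trans (cong (λ x → 𝟙 (α x) * 𝟙 (β (a-h a))) (unshift a<v)) (*-comm (𝟙 (α a)) _)) ⟩
  overlapAt v β α (v ∸ h) ∎
  where
  F = λ b → 𝟙 (α ((b + h) % v)) * 𝟙 (β b)
  a-h = λ a → (a + (v ∸ h)) % v
  unshift : ∀ {a} → a < v → (a-h a + h) % v ≡ a
  unshift {a} a<v = begin
    ((a + (v ∸ h)) % v + h) % v ≡⟨ [m%n+o]%n≡[m+o]%n (a + (v ∸ h)) h v ⟩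
    (a + (v ∸ h) + h) % v       ≡⟨ cong (_% v) (+-assoc a (v ∸ h) h) ⟩
    (a + (v ∸ h + h)) % v       ≡⟨ cong (λ x → (a + x) % v) (m∸n+n≡m h≤v) ⟩
    (a + v) % v                 ≡⟨ [m+n]%n≡m%n a v ⟩
    a % v                       ≡⟨ m<n⇒m%n≡m a<v ⟩
    a                           ∎

Periodic : (P : ℕ) .{{_ : NonZero P}} → (ℕ → Bool) → Set
Periodic P α = ∀ n → α (n % P) ≡ α n

periodic-∣ : ∀ {P v} .{{_ : NonZero P}} .{{_ : NonZero v}} {α : ℕ → Bool} →
             P ∣ v → Periodic P α → Periodic v α
periodic-∣ {P} {v} {α = α} P∣v α-per n = begin
  α (n % v)     ≡⟨ sym (α-per (n % v)) ⟩
  α (n % v % P) ≡⟨ cong α (m∣n⇒o%n%m≡o%m P v n P∣v) ⟩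
  α (n % P)     ≡⟨ α-per n ⟩
  α n           ∎

module _ {v Q P : ℕ} .{{_ : NonZero v}} .{{_ : NonZero P}} (v≡QP : v ≡ Q * P) where

  count-low : {α : ℕ → Bool} → Periodic P α → count v α ≡ count P α * Q
  count-low {α} α-per = begin
    ∑ v (𝟙 ∘ α)
      ≡⟨ ∑-cong v (λ n _ → trans (cong 𝟙 (sym (α-per n))) (sym (*-identityʳ _))) ⟩
    ∑ v (λ n → 𝟙 (α (n % P)) * 1)
      ≡⟨ cong (λ m → ∑ m _) v≡QP ⟩
    ∑ (Q * P) (λ n → 𝟙 (α (n % P)) * 1)
      ≡⟨ ∑-divMod Q P (𝟙 ∘ α) (λ _ → 1) ⟩
    count P α * ∑ Q (λ _ → 1)
      ≡⟨ cong (count P α *_) (trans (∑-const Q 1) (*-identityʳ Q)) ⟩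
    count P α * Q ∎

  count-high : {β w : ℕ → Bool} → (∀ n → β n ≡ w (n / P)) → count v β ≡ P * count Q w
  count-high {β} {w} β-high = begin
    ∑ v (𝟙 ∘ β)
      ≡⟨ ∑-cong v (λ n _ → trans (cong 𝟙 (β-high n)) (sym (*-identityˡ _))) ⟩
    ∑ v (λ n → 1 * 𝟙 (w (n / P)))
      ≡⟨ cong (λ m → ∑ m _) v≡QP ⟩
    ∑ (Q * P) (λ n → 1 * 𝟙 (w (n / P)))
      ≡⟨ ∑-divMod Q P (λ _ → 1) (𝟙 ∘ w) ⟩
    ∑ P (λ _ → 1) * count Q w
      ≡⟨ cong (_* count Q w) (trans (∑-const P 1) (*-identityʳ P)) ⟩
    P * count Q w ∎

  overlapAt-low-high : {α β w : ℕ → Bool} → Periodic P α → (∀ n → β n ≡ w (n / P)) →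
                       ∀ h → overlapAt v α β h ≡ count P α * count Q w
  overlapAt-low-high {α} {β} {w} α-per β-high h = begin
    ∑ v (λ b → 𝟙 (α ((b + h) % v)) * 𝟙 (β b))
      ≡⟨ ∑-cong v (λ b _ → cong₂ _*_ (cong 𝟙 (low b)) (cong 𝟙 (β-high b))) ⟩
    ∑ v (λ b → 𝟙 (α ((b % P + h) % P)) * 𝟙 (w (b / P)))
      ≡⟨ cong (λ m → ∑ m _) v≡QP ⟩
    ∑ (Q * P) (λ b → 𝟙 (α ((b % P + h) % P)) * 𝟙 (w (b / P)))
      ≡⟨ ∑-divMod Q P (λ r → 𝟙 (α ((r + h) % P))) (𝟙 ∘ w) ⟩
    ∑ P (λ r → 𝟙 (α ((r + h) % P))) * count Q w
      ≡⟨ cong (_* count Q w) (∑-rotate P h (𝟙 ∘ α)) ⟩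
    count P α * count Q w ∎
    where
    low : ∀ b → α ((b + h) % v) ≡ α ((b % P + h) % P)
    low b = begin
      α ((b + h) % v)       ≡⟨ periodic-∣ (divides Q v≡QP) α-per (b + h) ⟩
      α (b + h)             ≡⟨ sym (α-per (b + h)) ⟩
      α ((b + h) % P)       ≡⟨ cong α (sym ([m%n+o]%n≡[m+o]%n b h P)) ⟩
      α ((b % P + h) % P)   ∎

IsPSEDF-subsets : ∀ {v m k λ'} .{{_ : NonZero v}} (p : Fin m → ℕ → Bool) → 1 < m →
                  (∀ i → count v (p i) ≡ k) →
                  (∀ i j h → toℕ i < toℕ j → overlapAt v (p i) (p j) h ≡ λ') →
                  IsPSEDF v m k λ' (λ i → subset v (p i))
IsPSEDF-subsets {v} {λ' = λ'} p 1<m size ordered = 1<m , (λ i → trans (∣subset∣ v (p i)) (size i)) , Δ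
  where
  Δ : ∀ i j → ¬ i ≡ j → ΔIsλG (subset v (p i)) (subset v (p j)) λ'
  Δ i j i≢j g with <-cmp (toℕ i) (toℕ j)
  ... | tri< i<j _ _ = trans (Δmult-subset (p i) (p j) g) (ordered i j (toℕ g) i<j)
  ... | tri≈ _ i≡j _ = contradiction (toℕ-injective i≡j) i≢j
  ... | tri> _ _ j<i = begin
    Δmult (subset v (p i)) (subset v (p j)) g ≡⟨ Δmult-subset (p i) (p j) g ⟩
    overlapAt v (p i) (p j) (toℕ g)           ≡⟨ overlapAt-flip (p i) (p j) (<⇒≤ (toℕ<n g)) ⟩
    overlapAt v (p j) (p i) (v ∸ toℕ g)       ≡⟨ ordered j i (v ∸ toℕ g) j<i ⟩
    λ'                                        ∎

IsPSEDF⇒IsSEDF : ∀ {v m k λ'} (A : Fin m → Subset v) →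
                 IsPSEDF v m k λ' A → IsSEDF v m k ((m ∸ 1) * λ') A
IsPSEDF⇒IsSEDF {m = m} {λ' = λ'} A (1<m , size , Δ) = 1<m , size , λ i g →
  trans (Σfin≡∑ m (term i g)) (∑-all-but-one λ' (toℕ<n i))
  where
  term : ∀ i g j → (if does (i F.≟ j) then 0 else Δmult (A i) (A j) g)
                   ≡ (if does (toℕ j ≟ toℕ i) then 0 else λ')
  term i g j with i F.≟ j
  ... | yes refl = cong (λ b → if b then 0 else λ') (sym (dec-true (toℕ i ≟ toℕ i) refl))
  ... | no  i≢j  = trans (Δ i j i≢j g) (cong (λ b → if b then 0 else λ')
                           (sym (dec-false (toℕ j ≟ toℕ i) (i≢j ∘ sym ∘ toℕ-injective))))

count-<ᵇ : ∀ {n x} → x ≤ n → count n (_<ᵇ x) ≡ x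
count-<ᵇ {n}     {zero}  _         = ∑-zero n
count-<ᵇ {suc n} {suc x} (s≤s x≤n) = cong suc (count-<ᵇ x≤n)

lowHigh : ∀ x y .{{_ : NonZero y}} → Fin 2 → ℕ → Bool
lowHigh x y F.zero    n = n % y <ᵇ x
lowHigh x y (F.suc _) n = n / y <ᵇ x

lowHighSets : ∀ x y .{{_ : NonZero y}} → Fin 2 → Subset (y * y)
lowHighSets x y i = subset (y * y) (lowHigh x y i)

lowHigh-IsPSEDF : ∀ x y .{{_ : NonZero y}} → x ≤ y → IsPSEDF (y * y) 2 (x * y) (x * x) (lowHighSets x y)
lowHigh-IsPSEDF x y x≤y = IsPSEDF-subsets (lowHigh x y) (s≤s (s≤s z≤n)) size ordered
  where
  instance y*y≢0 = m*n≢0 y y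
  low-periodic : Periodic y (lowHigh x y F.zero)
  low-periodic n = cong (_<ᵇ x) (m%n%n≡m%n n y)
  count-low-y : count y (lowHigh x y F.zero) ≡ x
  count-low-y = trans (∑-cong y (λ r r<y → cong (λ r′ → 𝟙 (r′ <ᵇ x)) (m<n⇒m%n≡m r<y))) (count-<ᵇ x≤y)
  size : ∀ i → count (y * y) (lowHigh x y i) ≡ x * y
  size F.zero           = trans (count-low {Q = y} {P = y} refl low-periodic) (cong (_* y) count-low-y)
  size (F.suc F.zero)   = begin
    count (y * y) (lowHigh x y (F.suc F.zero)) ≡⟨ count-high {Q = y} {P = y} refl (λ _ → refl) ⟩
    y * count y (_<ᵇ x)                         ≡⟨ cong (y *_) (count-<ᵇ x≤y) ⟩
    y * x                                       ≡⟨ *-comm y x ⟩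
    x * y                                       ∎
  ordered : ∀ i j h → toℕ i < toℕ j → overlapAt (y * y) (lowHigh x y i) (lowHigh x y j) h ≡ x * x
  ordered F.zero         (F.suc F.zero) h _ =
    trans (overlapAt-low-high {Q = y} {P = y} refl low-periodic (λ _ → refl) h)
          (cong₂ _*_ count-low-y (count-<ᵇ x≤y))
  ordered F.zero         F.zero         h ()
  ordered (F.suc F.zero) F.zero         h ()
  ordered (F.suc F.zero) (F.suc F.zero) h (s≤s ())

module ZeroDigit (S : ℕ) .{{_ : NonZero S}} where

  zeroDigit : ℕ → ℕ → Bool
  zeroDigit k n = n / S ^ k % S ≡ᵇ 0
    where instance S^k≢0 = m^n≢0 S k

  zeroDigit-periodic : ∀ k → Periodic (S ^ suc k) {{m^n≢0 S (suc k)}} (zeroDigit k)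
  zeroDigit-periodic k n = cong (_≡ᵇ 0) (begin
    n % (S * S ^ k) / S ^ k % S ≡⟨ cong (_% S) (m%[n*o]/o≡m/o%n n S (S ^ k)) ⟩
    n / S ^ k % S % S           ≡⟨ m%n%n≡m%n (n / S ^ k) S ⟩
    n / S ^ k % S               ∎)
    where instance S^k≢0 = m^n≢0 S k
                   S^1+k≢0 = m^n≢0 S (suc k)

  zeroDigit-high : ∀ a e n → zeroDigit (suc a + e) n ≡ zeroDigit e ((n / S ^ suc a) {{m^n≢0 S (suc a)}})
  zeroDigit-high a e n = cong (λ d → d % S ≡ᵇ 0) (sym (begin
    n / S ^ suc a / S ^ e   ≡⟨ m/n/o≡m/[n*o] n (S ^ suc a) (S ^ e) ⟩
    n / (S ^ suc a * S ^ e) ≡⟨ /-congʳ (sym (^-distribˡ-+-* S (suc a) e)) ⟩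
    n / S ^ (suc a + e)     ∎))
    where instance S^e≢0 = m^n≢0 S e
                   S^1+a≢0 = m^n≢0 S (suc a)
                   S^1+a+e≢0 = m^n≢0 S (suc a + e)
                   S^1+a*S^e≢0 = m*n≢0 (S ^ suc a) (S ^ e)

  count-zeroDigit-top : ∀ k → count (S ^ suc k) (zeroDigit k) ≡ S ^ k
  count-zeroDigit-top k = begin
    count (S ^ suc k) (zeroDigit k)    ≡⟨ count-high {Q = S} {P = S ^ k} refl (λ _ → refl) ⟩
    S ^ k * count S (λ q → q % S ≡ᵇ 0) ≡⟨ cong (S ^ k *_) (count-%≡ᵇ0 S) ⟩
    S ^ k * 1                          ≡⟨ *-identityʳ (S ^ k) ⟩
    S ^ k                              ∎
    where
    instance S^k≢0 = m^n≢0 S k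
             S^1+k≢0 = m^n≢0 S (suc k)
    count-%≡ᵇ0 : ∀ n .{{_ : NonZero n}} → count n (λ q → q % n ≡ᵇ 0) ≡ 1
    count-%≡ᵇ0 n@(suc n-1) = cong suc (trans
      (∑-cong n-1 (λ q q<n → cong (λ r → 𝟙 (r ≡ᵇ 0)) (m<n⇒m%n≡m (s<s q<n))))
      (∑-zero n-1))

  count-zeroDigit : ∀ k t → count (S ^ suc (k + t)) (zeroDigit k) ≡ S ^ (k + t)
  count-zeroDigit k t = begin
    count (S ^ suc (k + t)) (zeroDigit k)
      ≡⟨ count-low {Q = S ^ t} {P = S ^ suc k} S^[1+k+t]≡S^t*S^[1+k] (zeroDigit-periodic k) ⟩
    count (S ^ suc k) (zeroDigit k) * S ^ t
      ≡⟨ cong (_* S ^ t) (count-zeroDigit-top k) ⟩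
    S ^ k * S ^ t
      ≡⟨ sym (^-distribˡ-+-* S k t) ⟩
    S ^ (k + t) ∎
    where
    instance S^1+k≢0 = m^n≢0 S (suc k)
             S^1+k+t≢0 = m^n≢0 S (suc (k + t))
    S^[1+k+t]≡S^t*S^[1+k] : S ^ suc (k + t) ≡ S ^ t * S ^ suc k
    S^[1+k+t]≡S^t*S^[1+k] = trans (^-distribˡ-+-* S (suc k) t) (*-comm (S ^ suc k) (S ^ t))

  count-zeroDigit-< : ∀ {k N} → k < N → count (S ^ N) (zeroDigit k) ≡ S ^ (N ∸ 1)
  count-zeroDigit-< {k} k<N with m≤n⇒∃[o]m+o≡n k<N
  ... | t , refl = count-zeroDigit k t

  overlapAt-zeroDigit : ∀ {a b N} → a < b → b < N → ∀ h →
                        overlapAt (S ^ N) {{m^n≢0 S N}} (zeroDigit a) (zeroDigit b) h ≡ S ^ (N ∸ 2)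
  overlapAt-zeroDigit {a} a<b b<N h with m≤n⇒∃[o]m+o≡n a<b | m≤n⇒∃[o]m+o≡n b<N
  ... | e , refl | t , refl = begin
    overlapAt (S ^ N) (zeroDigit a) (zeroDigit (suc a + e)) h
      ≡⟨ overlapAt-low-high {Q = S ^ suc (e + t)} {P = S ^ suc a} S^N≡S^[1+e+t]*S^[1+a]
           (zeroDigit-periodic a) (zeroDigit-high a e) h ⟩
    count (S ^ suc a) (zeroDigit a) * count (S ^ suc (e + t)) (zeroDigit e)
      ≡⟨ cong₂ _*_ (count-zeroDigit-top a) (count-zeroDigit e t) ⟩
    S ^ a * S ^ (e + t)
      ≡⟨ sym (^-distribˡ-+-* S a (e + t)) ⟩
    S ^ (a + (e + t))
      ≡⟨ cong (S ^_) (sym (+-assoc a e t)) ⟩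
    S ^ (N ∸ 2) ∎
    where
    N = suc (suc (a + e) + t)
    instance S^N≢0 = m^n≢0 S N
             S^1+a≢0 = m^n≢0 S (suc a)
    N≡[1+e+t]+[1+a] : N ≡ suc (e + t) + suc a
    N≡[1+e+t]+[1+a] = cong suc (trans (cong suc (trans (+-assoc a e t) (+-comm a (e + t))))
                                      (sym (+-suc (e + t) a)))
    S^N≡S^[1+e+t]*S^[1+a] : S ^ N ≡ S ^ suc (e + t) * S ^ suc a
    S^N≡S^[1+e+t]*S^[1+a] = trans (cong (S ^_) N≡[1+e+t]+[1+a]) (^-distribˡ-+-* S (suc (e + t)) (suc a))

  zeroDigitSets : ∀ N → Fin N → Subset (S ^ N)
  zeroDigitSets N i = subset (S ^ N) (zeroDigit (toℕ i))

  zeroDigits-IsPSEDF : ∀ N → 1 < N → IsPSEDF (S ^ N) N (S ^ (N ∸ 1)) (S ^ (N ∸ 2)) (zeroDigitSets N)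
  zeroDigits-IsPSEDF N 1<N = IsPSEDF-subsets (zeroDigit ∘ toℕ) 1<N
    (λ i → count-zeroDigit-< (toℕ<n i))
    (λ i j h i<j → overlapAt-zeroDigit i<j (toℕ<n j) h)
    where instance S^N≢0 = m^n≢0 S N

corollary3p6 :
    ((S N : ℕ) → 1 < S → 2 < N →
      Σ (Fin N → Subset (S ^ N)) (λ A → IsPSEDF (S ^ N) N (S ^ (N ∸ 1)) (S ^ (N ∸ 2)) A)
      × Σ (Fin N → Subset (S ^ N)) (λ A → IsSEDF (S ^ N) N (S ^ (N ∸ 1)) ((N ∸ 1) * S ^ (N ∸ 2)) A))
    × ((x y : ℕ) → x < y →
      Σ (Fin 2 → Subset (y * y)) (λ A → IsPSEDF (y * y) 2 (x * y) (x * x) A)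
      × Σ (Fin 2 → Subset (y * y)) (λ A → IsSEDF (y * y) 2 (x * y) (x * x) A))
corollary3p6 =
  (λ { S@(suc _) N _ 2<N →
       let open ZeroDigit S
           psedf = zeroDigits-IsPSEDF N (<-trans (s<s z<s) 2<N)
       in (zeroDigitSets N , psedf) , (zeroDigitSets N , IsPSEDF⇒IsSEDF (zeroDigitSets N) psedf) }) ,
  (λ { x y@(suc _) x<y →
       let psedf = lowHigh-IsPSEDF x y (<⇒≤ x<y)
       in (lowHighSets x y , psedf) ,
          (lowHighSets x y , subst (λ λ' → IsSEDF (y * y) 2 (x * y) λ' (lowHighSets x y))
                                   (*-identityˡ (x * x)) (IsPSEDF⇒IsSEDF (lowHighSets x y) psedf)) })
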